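{- Let $\mathcal{T}$ be a set of triples $(i,j,k)$ of distinct integers in $\{1,\dots,n\}$, and let $k\ge 2$. The following are equivalent: (1) for all $a,b$, the vertices $(a,b)$ and $(b,a)$ lie in different strong components of $\mathbb{D}(\mathcal{T})$; (2) $\mathbb{H}(\mathcal{T})$ admits a conservative commutative binary polymorphism; (3) $\mathbb{H}(\mathcal{T})$ admits a conservative $k$-ary totally symmetric polymorphism; (4) $\mathbb{H}(\mathcal{T})$ admits a conservative set polymorphism. If moreover $k$ is even, these are also equivalent to: (5) $\mathbb{H}(\mathcal{T})$ admits a conservative $k$-ary symmetric polymorphism; (6) $\mathbb{H}(\mathcal{T})$ admits a conservative $k$-ary cyclic polymorphism.
   Context: $\mathbb{H}(\mathcal{T})$ is the relational structure with universe $\{1,\dots,n\}$ and, for each $(a,b,c)\in\mathcal{T}$, the binary relation $\{(a,b),(b,b),(b,c)\}$. $\mathbb{D}(\mathcal{T})$ is the digraph whose vertices are the pairs $(a,b)$ of distinct integers that occur in consecutive positions, in either order, of some triple of $\mathcal{T}$, with an arc $(a,b)\to(b',c)$ iff $b=b'$ and either $(a,b,c)\in\mathcal{T}$ or $(c,b,a)\in\mathcal{T}$. A $k$-ary polymorphism is an operation that, applied coordinatewise to $k$ tuples of any relation, yields a tuple of that relation; it is conservative if $f(x_1,\dots,x_k)\in\{x_1,\dots,x_k\}$; commutative (binary) if $f(x,y)=f(y,x)$; cyclic if $f(x_1,\dots,x_k)=f(x_k,x_1,\dots,x_{k-1})$; symmetric if invariant under all permutations of arguments; totally symmetric if $f(x_1,\dots,x_k)=f(y_1,\dots,y_k)$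 whenever $\{x_i\}=\{y_i\}$. The power structure of $\mathbb{H}$ has universe the nonempty subsets of $H$, with $(X_1,\dots,X_r)$ in the relation corresponding to $\theta$ iff for every $i$ and $a\in X_i$ some $(x_1,\dots,x_r)\in\theta\cap\prod X_i$ has $x_i=a$; a set polymorphism is a homomorphism from the power structure to $\mathbb{H}$, conservative if $f(X)\in X$. -}

module Defs where

open import Data.Nat using (ℕ; zero; suc)
open import Data.Fin using (Fin; zero; suc; fromℕ; inject₁)
open import Data.Fin.Subset using (Subset) renaming (_∈_ to _∈ˢ_)
open import Data.Fin.Permutation using (Permutation′; _⟨$⟩ʳ_)
open import Data.Vec using ([]; _∷_)
open import Data.Bool using (Bool; true; false; _∨_; T)
open import Data.Product using (Σ; ∃; ∃-syntax; _×_; _,_)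
open import Data.Sum using (_⊎_)
open import Data.List using (List)
open import Data.List.Membership.Propositional using (_∈_)
open import Data.List.Relation.Unary.All using (All)
open import Relation.Binary.PropositionalEquality using (_≡_; _≢_)
open import Relation.Binary.Construct.Closure.ReflexiveTransitive using (Star)
open import Relation.Nullary using (¬_)

-- Universe {1,…,n} is represented by Fin n.
Triple : ℕ → Set
Triple n = Fin n × Fin n × Fin n

Distinct : ∀ {n} → Triple n → Set
Distinct (a , b , c) = a ≢ b × b ≢ c × a ≢ c

Triples : ℕ → Set
Triples n = List (Triple n)

-- The structure ℍ(𝒯): for each (a,b,c) ∈ 𝒯 the relation {(a,b),(b,b),(b,c)}

Rel₃ : ∀ {n} → Triple n → Fin n → Fin n → Set
Rel₃ (a , b , c) x y = (x ≡ a × y ≡ b) ⊎ (x ≡ b × y ≡ b) ⊎ (x ≡ b × y ≡ c)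

Op : ℕ → ℕ → Set
Op n k = (Fin k → Fin n) → Fin n

IsPolymorphism : ∀ {n k} → Triples n → Op n k → Set
IsPolymorphism {n} {k} 𝒯 f =
  ∀ {t} → t ∈ 𝒯 → (xs ys : Fin k → Fin n) →
  (∀ i → Rel₃ t (xs i) (ys i)) → Rel₃ t (f xs) (f ys)

IsConservative : ∀ {n k} → Op n k → Set
IsConservative {n} {k} f = ∀ (xs : Fin k → Fin n) → ∃[ i ] f xs ≡ xs i

IsBinPolymorphism : ∀ {n} → Triples n → (Fin n → Fin n → Fin n) → Set
IsBinPolymorphism 𝒯 f =
  ∀ {t} → t ∈ 𝒯 → ∀ x₁ x₂ y₁ y₂ →
  Rel₃ t x₁ y₁ → Rel₃ t x₂ y₂ → Rel₃ t (f x₁ x₂) (f y₁ y₂)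

IsBinConservative : ∀ {n} → (Fin n → Fin n → Fin n) → Set
IsBinConservative f = ∀ x y → f x y ≡ x ⊎ f x y ≡ y

IsCommutative : ∀ {n} → (Fin n → Fin n → Fin n) → Set
IsCommutative f = ∀ x y → f x y ≡ f y x

-- rot i = i - 1 (mod k); so (xs ∘ rot) = (x_k, x_1, …, x_{k-1})
rot : ∀ {k} → Fin k → Fin k
rot {suc m} zero    = fromℕ m
rot {suc m} (suc i) = inject₁ i

IsCyclic : ∀ {n k} → Op n k → Set
IsCyclic {n} {k} f = ∀ (xs : Fin k → Fin n) → f xs ≡ f (λ i → xs (rot i))

IsSymmetric : ∀ {n k} → Op n k → Set
IsSymmetric {n} {k} f =
  ∀ (xs : Fin k → Fin n) (π : Permutation′ k) → f xs ≡ f (λ i → xs (π ⟨$⟩ʳ i))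

IsTotallySymmetric : ∀ {n k} → Op n k → Set
IsTotallySymmetric {n} {k} f =
  ∀ (xs ys : Fin k → Fin n) →
  (∀ i → ∃[ j ] xs i ≡ ys j) → (∀ j → ∃[ i ] ys j ≡ xs i) → f xs ≡ f ys

nonempty : ∀ {n} → Subset n → Bool
nonempty []      = false
nonempty (b ∷ X) = b ∨ nonempty X

-- nonempty subsets of Fin n (the proof component is propositional)
NESubset : ℕ → Set
NESubset n = Σ (Subset n) (λ X → T (nonempty X))

PowerRel : ∀ {n} → (Fin n → Fin n → Set) → NESubset n → NESubset n → Set
PowerRel θ (X , _) (Y , _) =
  (∀ a → a ∈ˢ X → ∃[ y ] (y ∈ˢ Y × θ a y)) ×
  (∀ b → b ∈ˢ Y → ∃[ x ] (x ∈ˢ X × θ x b))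

IsSetPolymorphism : ∀ {n} → Triples n → (NESubset n → Fin n) → Set
IsSetPolymorphism 𝒯 f =
  ∀ {t} → t ∈ 𝒯 → ∀ X Y → PowerRel (Rel₃ t) X Y → Rel₃ t (f X) (f Y)

IsSetConservative : ∀ {n} → (NESubset n → Fin n) → Set
IsSetConservative f = ∀ X → f X ∈ˢ Data.Product.proj₁ X

Pair : ℕ → Set
Pair n = Fin n × Fin n

IsVertex : ∀ {n} → Triples n → Pair n → Set
IsVertex 𝒯 (a , b) = a ≢ b × ∃[ t ] (t ∈ 𝒯 × Consec t)
  where
  Consec : _ → Set
  Consec (x , y , z) =
    (a ≡ x × b ≡ y) ⊎ (a ≡ y × b ≡ x) ⊎ (a ≡ y × b ≡ z) ⊎ (a ≡ z × b ≡ y)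

Arc : ∀ {n} → Triples n → Pair n → Pair n → Set
Arc 𝒯 (a , b) (b′ , c) =
  IsVertex 𝒯 (a , b) × IsVertex 𝒯 (b′ , c) ×
  b ≡ b′ × ((a , b , c) ∈ 𝒯 ⊎ (c , b , a) ∈ 𝒯)

Reach : ∀ {n} → Triples n → Pair n → Pair n → Set
Reach 𝒯 = Star (Arc 𝒯)

SameStrongComponent : ∀ {n} → Triples n → Pair n → Pair n → Set
SameStrongComponent 𝒯 u v = Reach 𝒯 u v × Reach 𝒯 v u

Cond1 : ∀ {n} → Triples n → Set
Cond1 {n} 𝒯 = ∀ (a b : Fin n) → IsVertex 𝒯 (a , b) →
  ¬ SameStrongComponent 𝒯 (a , b) (b , a)

Cond2 : ∀ {n} → Triples n → Set
Cond2 {n} 𝒯 = ∃[ f ] (IsBinPolymorphism {n} 𝒯 f × IsBinConservative f × IsCommutative f)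

Cond3 : ∀ {n} → Triples n → ℕ → Set
Cond3 {n} 𝒯 k = ∃[ f ] (IsPolymorphism {n} {k} 𝒯 f × IsConservative f × IsTotallySymmetric f)

Cond4 : ∀ {n} → Triples n → Set
Cond4 {n} 𝒯 = ∃[ f ] (IsSetPolymorphism {n} 𝒯 f × IsSetConservative f)

Cond5 : ∀ {n} → Triples n → ℕ → Set
Cond5 {n} 𝒯 k = ∃[ f ] (IsPolymorphism {n} {k} 𝒯 f × IsConservative f × IsSymmetric f)

Cond6 : ∀ {n} → Triples n → ℕ → Set
Cond6 {n} 𝒯 k = ∃[ f ] (IsPolymorphism {n} {k} 𝒯 f × IsConservative f × IsCyclic f)

-- Read a vertex (a, b) of 𝔻(𝒯) as the proposition "a is chosen from {a, b}". A conservative commutative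
-- binary polymorphism is then a choice from every pair under which each arc of 𝔻(𝒯) is an implication,
-- and (1) is the 2-SAT criterion that no proposition (a, b) is equivalent to its negation (b, a). Such a
-- choice c is built by adding, pair by pair, an arc from the negation to the pair unless that creates an
-- equivalence. It extends to the conservative set polymorphism X ↦ c (min X) (max X), because only subsets
-- of the two-element sets {a, b} and {b, d} of a triple occur; composing with the value set of a tuple gives
-- totally symmetric, hence symmetric and cyclic, polymorphisms of every arity. Conversely, two-argument
-- restrictions of totally symmetric polymorphisms are commutative, and for even k a symmetric or cyclic
-- polymorphism takes the same value on (x, y, x, y, …) and (y, x, y, x, …).

module Submission where

open import Defs
open import Data.Nat using (ℕ; _≤_)
open import Data.Nat.Divisibility using (_∣_)
open import Data.Product using (_×_)
open import Data.List.Relation.Unary.All using (All)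
open import Function.Bundles using (_⇔_)

open import Data.Bool using (true; false; T)
open import Data.Bool.Properties using (T-irrelevant)
open import Data.Fin using (Fin; zero; suc; toℕ; fromℕ; inject₁; lower₁; opposite; _≟_; _≤?_)
import Data.Fin as Fin
open import Data.Fin.Permutation using (_⟨$⟩ʳ_; _⟨$⟩ˡ_; inverseʳ; reverse)
open import Data.Fin.Properties
  using (≤-antisym; ≤-total; any?; toℕ-injective; toℕ-fromℕ; toℕ-inject₁; inject₁-lower₁; opposite-prop; toℕ≤pred[n])
open import Data.Fin.Subset using (Subset) renaming (_∈_ to _∈ˢ_)
open import Data.List using (List; []; _∷_; allFin; cartesianProduct)
open import Data.List.Membership.Propositional using (_∈_)
open import Data.List.Membership.Propositional.Properties using (∈-allFin; ∈-cartesianProduct⁺)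
import Data.List.Membership.DecPropositional as DecMembership
open import Data.List.Relation.Unary.All using (lookup)
open import Data.List.Relation.Unary.Any using (here; there)
open import Data.Nat using (suc; z≤n; s≤s; parity)
import Data.Nat as ℕ
open import Data.Nat.Divisibility using (divides)
open import Data.Nat.Properties using (m∸n+n≡m)
open import Data.Parity using (Parity; 0ℙ; 1ℙ; _⁻¹; _+_)
open import Data.Parity.Properties using (suc-homo-⁻¹; +-homo-+; *-homo-*; *-zeroʳ; +-cancelʳ-≡; p⁻¹+p≡1ℙ)
open import Data.Product using (_,_; proj₁; proj₂; ∃-syntax; swap)
open import Data.Product.Properties using (≡-dec)
open import Data.Sum using (_⊎_; inj₁; inj₂)
open import Data.Unit using (tt)
open import Data.Vec using (_∷_; tabulate; here; there)
open import Data.Vec.Properties using (lookup∘tabulate; lookup⇒[]=; []=⇒lookup; tabulate-cong)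
open import Function using (id; _∘_; _∘′_)
open import Function.Bundles using (mk⇔)
open import Relation.Binary.Definitions using (DecidableEquality; Decidable)
open import Relation.Binary.PropositionalEquality
  using (_≡_; _≢_; refl; sym; trans; cong; cong₂; subst; subst₂; module ≡-Reasoning)
open import Relation.Binary.Construct.Closure.ReflexiveTransitive using (Star; ε; _◅_; _◅◅_; gmap)
open import Relation.Nullary using (¬_; yes; no; contradiction; does)
open import Relation.Nullary.Decidable using (map′; _⊎-dec_; _×-dec_; T?; dec-true; does-⇔)

private variable n k : ℕ

module Reachability {A : Set} (_≟_ : DecidableEquality A) {enum : List A} (complete : ∀ x → x ∈ enum)
  (R : A → A → Set) (R? : Decidable R) where

  -- Floyd–Warshall: nonempty paths whose intermediate vertices lie in U.
  data PathVia (U : List A) : A → A → Set where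
    edge : ∀ {x y} → R x y → PathVia U x y
    _◅[_]_ : ∀ {x z y} → R x z → z ∈ U → PathVia U z y → PathVia U x y

  widen : ∀ {u U x y} → PathVia U x y → PathVia (u ∷ U) x y
  widen (edge r) = edge r
  widen (r ◅[ z∈U ] p) = r ◅[ there z∈U ] widen p

  join : ∀ {U x u y} → PathVia U x u → u ∈ U → PathVia U u y → PathVia U x y
  join (edge r) u∈U q = r ◅[ u∈U ] q
  join (r ◅[ z∈U ] p) u∈U q = r ◅[ z∈U ] join p u∈U q

  splitAt : ∀ {u U x y} → PathVia (u ∷ U) x y →
            PathVia U x y ⊎ (PathVia U x u × PathVia U u y)
  splitAt (edge r) = inj₁ (edge r)
  splitAt (r ◅[ here refl ] p) with splitAt p
  ... | inj₁ q = inj₂ (edge r , q)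
  ... | inj₂ (_ , q) = inj₂ (edge r , q)
  splitAt (r ◅[ there z∈U ] p) with splitAt p
  ... | inj₁ q = inj₁ (r ◅[ z∈U ] q)
  ... | inj₂ (q₁ , q₂) = inj₂ (r ◅[ z∈U ] q₁ , q₂)

  PathVia? : ∀ U → Decidable (PathVia U)
  PathVia? [] x y = map′ edge (λ { (edge r) → r ; (_ ◅[ () ] _) }) (R? x y)
  PathVia? (u ∷ U) x y = map′
    (λ { (inj₁ p) → widen p ; (inj₂ (p , q)) → join (widen p) (here refl) (widen q) })
    splitAt
    (PathVia? U x y ⊎-dec (PathVia? U x u ×-dec PathVia? U u y))

  toStar : ∀ {U x y} → PathVia U x y → Star R x y
  toStar (edge r) = r ◅ ε
  toStar (r ◅[ _ ] p) = r ◅ toStar p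

  fromStar : ∀ {x y} → Star R x y → x ≡ y ⊎ PathVia enum x y
  fromStar ε = inj₁ refl
  fromStar (r ◅ s) with fromStar s
  ... | inj₁ refl = inj₂ (edge r)
  ... | inj₂ p = inj₂ (r ◅[ complete _ ] p)

  Star? : Decidable (Star R)
  Star? x y = map′ (λ { (inj₁ refl) → ε ; (inj₂ p) → toStar p }) fromStar
    ((x ≟ y) ⊎-dec PathVia? enum x y)

_∪⟦_↦_⟧ : ∀ {B : Set} → (B → B → Set) → B → B → B → B → Set
(R ∪⟦ x ↦ y ⟧) u v = R u v ⊎ (u ≡ x × v ≡ y)

star-∪⟦↦⟧ : ∀ {B : Set} {R : B → B → Set} {x y u w} → Star (R ∪⟦ x ↦ y ⟧) u w →
            Star R u w ⊎ (Star R u x × Star R y w)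
star-∪⟦↦⟧ ε = inj₁ ε
star-∪⟦↦⟧ (inj₁ r ◅ s) with star-∪⟦↦⟧ s
... | inj₁ p = inj₁ (r ◅ p)
... | inj₂ (p , q) = inj₂ (r ◅ p , q)
star-∪⟦↦⟧ (inj₂ (refl , refl) ◅ s) with star-∪⟦↦⟧ s
... | inj₁ p = inj₂ (ε , p)
... | inj₂ (_ , q) = inj₂ (ε , q)

module PairCompletion {A : Set} (_≟_ : DecidableEquality A) {enum : List A} (complete : ∀ x → x ∈ enum) where

  Consistent : (A × A → A × A → Set) → Set
  Consistent R = ∀ {a b} → a ≢ b → Star R (a , b) (b , a) → ¬ Star R (b , a) (a , b)

  private
    pairs : List (A × A)
    pairs = cartesianProduct enum enum

    pairs-complete : ∀ l → l ∈ pairs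
    pairs-complete (a , b) = ∈-cartesianProduct⁺ (complete a) (complete b)

  Star? : ∀ {R} → Decidable R → Decidable (Star R)
  Star? {R} R? = Reachability.Star? (≡-dec _≟_ _≟_) pairs-complete R R?

  consistent-∪⟦↦⟧ : ∀ {R} l → Consistent R → ¬ Star R l (swap l) → Consistent (R ∪⟦ swap l ↦ l ⟧)
  consistent-∪⟦↦⟧ l consistent ¬l⇝l′ a≢b p q with star-∪⟦↦⟧ p | star-∪⟦↦⟧ q
  ... | inj₁ p′ | inj₁ q′ = consistent a≢b p′ q′
  ... | inj₁ p′ | inj₂ (q₁ , q₂) = ¬l⇝l′ (q₂ ◅◅ p′ ◅◅ q₁)
  ... | inj₂ (p₁ , p₂) | inj₁ q′ = ¬l⇝l′ (p₂ ◅◅ q′ ◅◅ p₁)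
  ... | inj₂ (p₁ , _) | inj₂ (_ , q₂) = ¬l⇝l′ (q₂ ◅◅ p₁)

  record Completion (R : A × A → A × A → Set) (ls : List (A × A)) : Set₁ where
    field
      Rel : A × A → A × A → Set
      Rel? : Decidable Rel
      extends : ∀ {u v} → R u v → Rel u v
      consistent : Consistent Rel
      decides : ∀ {l} → l ∈ ls → Star Rel l (swap l) ⊎ Star Rel (swap l) l

  completion : ∀ {R} → Decidable R → Consistent R → ∀ ls → Completion R ls
  completion R? consistent [] = record
    { Rel = _ ; Rel? = R? ; extends = id ; consistent = consistent ; decides = λ () }
  completion {R} R? consistent (l ∷ ls) with Star? R? l (swap l)
  ... | yes l⇝l′ = record
    { Rel = C.Rel ; Rel? = C.Rel? ; extends = C.extends ; consistent = C.consistent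
    ; decides = λ { (here refl) → inj₁ (gmap id C.extends l⇝l′) ; (there m) → C.decides m } }
    where module C = Completion (completion R? consistent ls)
  ... | no ¬l⇝l′ = record
    { Rel = C.Rel ; Rel? = C.Rel? ; extends = C.extends ∘ inj₁ ; consistent = C.consistent
    ; decides = λ { (here refl) → inj₂ (C.extends (inj₂ (refl , refl)) ◅ ε) ; (there m) → C.decides m } }
    where
    R⁺? : Decidable (R ∪⟦ swap l ↦ l ⟧)
    R⁺? u v = R? u v ⊎-dec ((u ≟ₚ swap l) ×-dec (v ≟ₚ l))
      where _≟ₚ_ = ≡-dec _≟_ _≟_
    module C = Completion (completion R⁺? (consistent-∪⟦↦⟧ l consistent ¬l⇝l′) ls)

  module Winner {R} (R? : Decidable R) (R-consistent : Consistent R) where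
    open Completion (completion R? R-consistent pairs)

    winner : A → A → A
    winner x y with Star? Rel? (y , x) (x , y)
    ... | yes _ = x
    ... | no _ = y

    winner-conservative : ∀ x y → winner x y ≡ x ⊎ winner x y ≡ y
    winner-conservative x y with Star? Rel? (y , x) (x , y)
    ... | yes _ = inj₁ refl
    ... | no _ = inj₂ refl

    winner-comm : ∀ x y → winner x y ≡ winner y x
    winner-comm x y with Star? Rel? (y , x) (x , y) | Star? Rel? (x , y) (y , x)
    ... | yes _ | no _ = refl
    ... | no _ | yes _ = refl
    ... | yes p | yes q with x ≟ y
    ...   | yes x≡y = x≡y
    ...   | no x≢y = contradiction p (consistent x≢y q)
    winner-comm x y | no p | no q with decides (pairs-complete (x , y))
    ... | inj₁ r = contradiction r q
    ... | inj₂ r = contradiction r p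

    Wins : A × A → Set
    Wins (x , y) = winner x y ≡ x

    wins⇒reach : ∀ {x y} → winner x y ≡ x → Star Rel (y , x) (x , y)
    wins⇒reach {x} {y} eq with Star? Rel? (y , x) (x , y)
    ... | yes p = p
    ... | no _ = subst (λ z → Star Rel (z , x) (x , z)) (sym eq) ε

    reach⇒wins : ∀ {x y} → Star Rel (y , x) (x , y) → winner x y ≡ x
    reach⇒wins {x} {y} p with Star? Rel? (y , x) (x , y)
    ... | yes _ = refl
    ... | no ¬p = contradiction p ¬p

    wins-propagates : ∀ {u v} → R u v → R (swap v) (swap u) → Wins u → Wins v
    wins-propagates r r′ w = reach⇒wins (extends r′ ◅ wins⇒reach w ◅◅ (extends r ◅ ε))

record PropagatingChoice {n} (𝒯 : Triples n) : Set where
  field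
    choose : Fin n → Fin n → Fin n
    conservative : IsBinConservative choose
    commutative : IsCommutative choose
    propagates : ∀ {a b d} → (a , b , d) ∈ 𝒯 → choose a b ≡ a → choose b d ≡ b

module _ {n} (𝒯 : Triples n) where

  -- The arcs of 𝔻(𝒯) without the requirement that their ends are vertices.
  Implies : Pair n → Pair n → Set
  Implies (a , b) (b′ , d) = b ≡ b′ × ((a , b , d) ∈ 𝒯 ⊎ (d , b , a) ∈ 𝒯)

  Implies? : Decidable Implies
  Implies? (a , b) (b′ , d) = (b ≟ b′) ×-dec (((a , b , d) ∈? 𝒯) ⊎-dec ((d , b , a) ∈? 𝒯))
    where open DecMembership (≡-dec _≟_ (≡-dec _≟_ _≟_)) using (_∈?_)

  arc⇒implies : ∀ {u v} → Arc 𝒯 u v → Implies u v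
  arc⇒implies (_ , _ , b≡b′ , t∈𝒯) = b≡b′ , t∈𝒯

  module _ (distinct : All Distinct 𝒯) where

    implies⇒arc : ∀ {u v} → Implies u v → Arc 𝒯 u v
    implies⇒arc {a , b} {_ , d} (refl , inj₁ t∈𝒯) with lookup distinct t∈𝒯
    ... | a≢b , b≢d , _ =
      (a≢b , _ , t∈𝒯 , inj₁ (refl , refl)) , (b≢d , _ , t∈𝒯 , inj₂ (inj₂ (inj₁ (refl , refl)))) ,
      refl , inj₁ t∈𝒯
    implies⇒arc {a , b} {_ , d} (refl , inj₂ t∈𝒯) with lookup distinct t∈𝒯
    ... | d≢b , b≢a , _ =
      (b≢a ∘′ sym , _ , t∈𝒯 , inj₂ (inj₂ (inj₂ (refl , refl)))) ,
      (d≢b ∘′ sym , _ , t∈𝒯 , inj₂ (inj₁ (refl , refl))) , refl , inj₂ t∈𝒯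

    open PairCompletion _≟_ {allFin n} ∈-allFin using (Consistent; module Winner)

    cond1⇒consistent : Cond1 𝒯 → Consistent Implies
    cond1⇒consistent _ a≢b ε _ = a≢b refl
    cond1⇒consistent c1 a≢b p@(i ◅ _) q =
      c1 _ _ (proj₁ (implies⇒arc i)) (gmap id implies⇒arc p , gmap id implies⇒arc q)

    consistent⇒choice : Consistent Implies → PropagatingChoice 𝒯
    consistent⇒choice consistent = record
      { choose = winner
      ; conservative = winner-conservative
      ; commutative = winner-comm
      ; propagates = λ t∈𝒯 → wins-propagates (refl , inj₁ t∈𝒯) (refl , inj₂ t∈𝒯)
      }
      where open Winner Implies? consistent

    module _ (C : PropagatingChoice 𝒯) where
      open PropagatingChoice C

      Wins : Pair n → Set
      Wins (x , y) = choose x y ≡ x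

      wins-along : ∀ {u v} → Implies u v → Wins u → Wins v
      wins-along (refl , inj₁ t∈𝒯) a-wins = propagates t∈𝒯 a-wins
      wins-along {a , b} {_ , d} (refl , inj₂ t∈𝒯) a-wins with conservative d b
      ... | inj₁ d-wins = contradiction (trans (sym a-wins) (trans (commutative a b) (propagates t∈𝒯 d-wins)))
                                        (proj₁ (proj₂ (lookup distinct t∈𝒯)) ∘′ sym)
      ... | inj₂ b-wins = trans (commutative b d) b-wins

      wins-along⋆ : ∀ {u v} → Star Implies u v → Wins u → Wins v
      wins-along⋆ ε w = w
      wins-along⋆ (i ◅ p) w = wins-along⋆ p (wins-along i w)

      choice⇒cond1 : Cond1 𝒯
      choice⇒cond1 a b (a≢b , _) (p , q) with conservative a b
      ... | inj₁ a-wins = a≢b (trans (sym a-wins) (trans (commutative a b) (wins-along⋆ (gmap id arc⇒implies p) a-wins)))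
      ... | inj₂ b-wins = a≢b (trans (sym (wins-along⋆ (gmap id arc⇒implies q) (trans (commutative b a) b-wins))) b-wins)

∈⇒nonempty : ∀ {X : Subset n} {z} → z ∈ˢ X → T (nonempty X)
∈⇒nonempty {X = true ∷ _} _ = tt
∈⇒nonempty {X = false ∷ _} (there z∈X) = ∈⇒nonempty z∈X

first : (X : Subset n) → T (nonempty X) → Fin n
first (true ∷ X) _ = zero
first (false ∷ X) p = suc (first X p)

first-∈ : ∀ (X : Subset n) p → first X p ∈ˢ X
first-∈ (true ∷ X) _ = here
first-∈ (false ∷ X) p = there (first-∈ X p)

first-≤ : ∀ (X : Subset n) p {z} → z ∈ˢ X → first X p Fin.≤ z
first-≤ (true ∷ X) _ _ = z≤n
first-≤ (false ∷ X) p (there z∈X) = s≤s (first-≤ X p z∈X)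

last : (X : Subset n) → T (nonempty X) → Fin n
last (_ ∷ X) _ with T? (nonempty X)
... | yes q = suc (last X q)
... | no _ = zero

last-∈ : ∀ (X : Subset n) p → last X p ∈ˢ X
last-∈ (b ∷ X) p with T? (nonempty X)
last-∈ (b ∷ X) p | yes q = there (last-∈ X q)
last-∈ (true ∷ X) p | no _ = here
last-∈ (false ∷ X) p | no ¬p = contradiction p ¬p

last-≥ : ∀ (X : Subset n) p {z} → z ∈ˢ X → z Fin.≤ last X p
last-≥ (_ ∷ X) _ {zero} _ = z≤n
last-≥ (_ ∷ X) _ {suc z} (there z∈X) with T? (nonempty X)
... | yes q = s≤s (last-≥ X q z∈X)
... | no ¬q = contradiction (∈⇒nonempty z∈X) ¬q

NESubset-≡ : ∀ {X Y : Subset n} {p q} → X ≡ Y → _≡_ {A = NESubset n} (X , p) (Y , q)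
NESubset-≡ {X = X} refl = cong (X ,_) (T-irrelevant _ _)

Members : NESubset n → Fin n → Set
Members X z = z ∈ˢ proj₁ X

module SetChoice (c : Fin n → Fin n → Fin n) (conservative : IsBinConservative c) (commutative : IsCommutative c) where

  -- In the polymorphism property only subsets of two-element sets {x, y} occur, and on those
  -- combining the least and the greatest element gives c x y.
  choiceˢ : NESubset n → Fin n
  choiceˢ (X , p) = c (first X p) (last X p)

  choiceˢ-∈ : ∀ X → choiceˢ X ∈ˢ proj₁ X
  choiceˢ-∈ (X , p) with conservative (first X p) (last X p)
  ... | inj₁ eq = subst (_∈ˢ X) (sym eq) (first-∈ X p)
  ... | inj₂ eq = subst (_∈ˢ X) (sym eq) (last-∈ X p)

  choiceˢ-pair : ∀ {x y} X → (∀ {z} → z ∈ˢ proj₁ X → z ≡ x ⊎ z ≡ y) → x ∈ˢ proj₁ X → y ∈ˢ proj₁ X → x ≢ y →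
                 choiceˢ X ≡ c x y
  choiceˢ-pair {x} {y} (X , p) ⊆xy x∈X y∈X x≢y with ⊆xy (first-∈ X p) | ⊆xy (last-∈ X p)
  ... | inj₁ f≡x | inj₂ l≡y = cong₂ c f≡x l≡y
  ... | inj₂ f≡y | inj₁ l≡x = trans (cong₂ c f≡y l≡x) (commutative y x)
  ... | inj₁ f≡x | inj₁ l≡x =
    contradiction (≤-antisym (subst (Fin._≤ y) f≡x (first-≤ X p y∈X)) (subst (y Fin.≤_) l≡x (last-≥ X p y∈X))) x≢y
  ... | inj₂ f≡y | inj₂ l≡y =
    contradiction (≤-antisym (subst (x Fin.≤_) l≡y (last-≥ X p x∈X)) (subst (Fin._≤ x) f≡y (first-≤ X p x∈X))) x≢y

module _ {a b d x y : Fin n} where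

  Rel₃-dom : Rel₃ (a , b , d) x y → x ≡ a ⊎ x ≡ b
  Rel₃-dom (inj₁ (x≡a , _)) = inj₁ x≡a
  Rel₃-dom (inj₂ (inj₁ (x≡b , _))) = inj₂ x≡b
  Rel₃-dom (inj₂ (inj₂ (x≡b , _))) = inj₂ x≡b

  Rel₃-cod : Rel₃ (a , b , d) x y → y ≡ b ⊎ y ≡ d
  Rel₃-cod (inj₁ (_ , y≡b)) = inj₁ y≡b
  Rel₃-cod (inj₂ (inj₁ (_ , y≡b))) = inj₁ y≡b
  Rel₃-cod (inj₂ (inj₂ (_ , y≡d))) = inj₂ y≡d

Rel₃-from-first : ∀ {a b d y : Fin n} → a ≢ b → Rel₃ (a , b , d) a y → y ≡ b
Rel₃-from-first _ (inj₁ (_ , y≡b)) = y≡b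
Rel₃-from-first a≢b (inj₂ (inj₁ (a≡b , _))) = contradiction a≡b a≢b
Rel₃-from-first a≢b (inj₂ (inj₂ (a≡b , _))) = contradiction a≡b a≢b

module _ {a b d : Fin n} (X Y : NESubset n) (XY : PowerRel (Rel₃ (a , b , d)) X Y) where

  PowerRel-dom : ∀ {z} → z ∈ˢ proj₁ X → z ≡ a ⊎ z ≡ b
  PowerRel-dom z∈X = Rel₃-dom (proj₂ (proj₂ (proj₁ XY _ z∈X)))

  PowerRel-cod : ∀ {z} → z ∈ˢ proj₁ Y → z ≡ b ⊎ z ≡ d
  PowerRel-cod z∈Y = Rel₃-cod (proj₂ (proj₂ (proj₂ XY _ z∈Y)))

  PowerRel-first : a ≢ b → a ∈ˢ proj₁ X → b ∈ˢ proj₁ Y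
  PowerRel-first a≢b a∈X with proj₁ XY a a∈X
  ... | y , y∈Y , r = subst (Members Y) (Rel₃-from-first a≢b r) y∈Y

  PowerRel-last : b ≢ d → d ∈ˢ proj₁ Y → b ∈ˢ proj₁ X
  PowerRel-last b≢d d∈Y with proj₂ XY d d∈Y
  ... | _ , _ , inj₁ (_ , d≡b) = contradiction (sym d≡b) b≢d
  ... | x , x∈X , inj₂ (inj₁ (x≡b , _)) = subst (Members X) x≡b x∈X
  ... | x , x∈X , inj₂ (inj₂ (x≡b , _)) = subst (Members X) x≡b x∈X

module _ {𝒯 : Triples n} (distinct : All Distinct 𝒯) (C : PropagatingChoice 𝒯) where
  open PropagatingChoice C
  open SetChoice choose conservative commutative

  choiceˢ-polymorphism : IsSetPolymorphism 𝒯 choiceˢ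
  choiceˢ-polymorphism {a , b , d} t∈𝒯 X Y XY
    with lookup distinct t∈𝒯 | PowerRel-dom X Y XY (choiceˢ-∈ X) | PowerRel-cod X Y XY (choiceˢ-∈ Y)
  ... | _ | inj₁ fX≡a | inj₁ fY≡b = inj₁ (fX≡a , fY≡b)
  ... | _ | inj₂ fX≡b | inj₁ fY≡b = inj₂ (inj₁ (fX≡b , fY≡b))
  ... | _ | inj₂ fX≡b | inj₂ fY≡d = inj₂ (inj₂ (fX≡b , fY≡d))
  ... | a≢b , b≢d , _ | inj₁ fX≡a | inj₂ fY≡d = contradiction b≡d b≢d
    where
    a∈X : a ∈ˢ proj₁ X
    a∈X = subst (Members X) fX≡a (choiceˢ-∈ X)
    d∈Y : d ∈ˢ proj₁ Y
    d∈Y = subst (Members Y) fY≡d (choiceˢ-∈ Y)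
    fX≡ab : choiceˢ X ≡ choose a b
    fX≡ab = choiceˢ-pair X (PowerRel-dom X Y XY) a∈X (PowerRel-last X Y XY b≢d d∈Y) a≢b
    fY≡bd : choiceˢ Y ≡ choose b d
    fY≡bd = choiceˢ-pair Y (PowerRel-cod X Y XY) (PowerRel-first X Y XY a≢b a∈X) d∈Y b≢d
    b≡d : b ≡ d
    b≡d = trans (sym (propagates t∈𝒯 (trans (sym fX≡ab) fX≡a))) (trans (sym fY≡bd) fY≡d)

image : ∀ {k} → (Fin k → Fin n) → Subset n
image xs = tabulate (λ z → does (any? (λ i → z ≟ xs i)))

∈-image⁺ : ∀ {k} (xs : Fin k → Fin n) i → xs i ∈ˢ image xs
∈-image⁺ xs i = lookup⇒[]= (xs i) (image xs)
  (trans (lookup∘tabulate _ (xs i)) (dec-true (any? (λ j → xs i ≟ xs j)) (i , refl)))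

∈-image⁻ : ∀ {k} (xs : Fin k → Fin n) {z} → z ∈ˢ image xs → ∃[ i ] z ≡ xs i
∈-image⁻ xs {z} z∈ with any? (λ i → z ≟ xs i) | trans (sym (lookup∘tabulate _ z)) ([]=⇒lookup z∈)
... | yes found | _ = found

image-cong : ∀ {k} (xs ys : Fin k → Fin n) →
  (∀ i → ∃[ j ] xs i ≡ ys j) → (∀ j → ∃[ i ] ys j ≡ xs i) → image xs ≡ image ys
image-cong xs ys xs⊆ys ys⊆xs = tabulate-cong λ z → does-⇔
  (mk⇔ (λ { (i , refl) → xs⊆ys i }) (λ { (j , refl) → ys⊆xs j }))
  (any? (λ i → z ≟ xs i)) (any? (λ j → z ≟ ys j))

module _ {𝒯 : Triples n} where

  cond4⇒cond3 : ∀ m → Cond4 𝒯 → Cond3 𝒯 (suc m)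
  cond4⇒cond3 m (F , F-poly , F-cons) = f , f-poly , f-cons , f-tsym
    where
    imageⁿᵉ : (Fin (suc m) → Fin n) → NESubset n
    imageⁿᵉ xs = image xs , ∈⇒nonempty (∈-image⁺ xs zero)

    f : Op n (suc m)
    f = F ∘ imageⁿᵉ

    f-poly : IsPolymorphism 𝒯 f
    f-poly {t} t∈𝒯 xs ys rel = F-poly t∈𝒯 (imageⁿᵉ xs) (imageⁿᵉ ys) (forth , back)
      where
      forth : ∀ z → z ∈ˢ image xs → ∃[ y ] (y ∈ˢ image ys × Rel₃ t z y)
      forth z z∈ with ∈-image⁻ xs z∈
      ... | i , refl = ys i , ∈-image⁺ ys i , rel i
      back : ∀ z → z ∈ˢ image ys → ∃[ x ] (x ∈ˢ image xs × Rel₃ t x z)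
      back z z∈ with ∈-image⁻ ys z∈
      ... | i , refl = xs i , ∈-image⁺ xs i , rel i

    f-cons : IsConservative f
    f-cons xs = ∈-image⁻ xs (F-cons (imageⁿᵉ xs))

    f-tsym : IsTotallySymmetric f
    f-tsym xs ys xs⊆ys ys⊆xs = cong F (NESubset-≡ (image-cong xs ys xs⊆ys ys⊆xs))

  choice⇒cond4 : All Distinct 𝒯 → PropagatingChoice 𝒯 → Cond4 𝒯
  choice⇒cond4 distinct C = choiceˢ , choiceˢ-polymorphism distinct C , choiceˢ-∈
    where open PropagatingChoice C
          open SetChoice choose conservative commutative

  cond3⇒cond2 : ∀ m → Cond3 𝒯 (suc (suc m)) → Cond2 𝒯
  cond3⇒cond2 m (f , f-poly , f-cons , f-tsym) = g , g-poly , g-cons , g-comm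
    where
    ⟨_,_⟩ : Fin n → Fin n → Fin (suc (suc m)) → Fin n
    ⟨ x , y ⟩ zero = x
    ⟨ x , y ⟩ (suc _) = y

    g : Fin n → Fin n → Fin n
    g x y = f ⟨ x , y ⟩

    g-poly : IsBinPolymorphism 𝒯 g
    g-poly t∈𝒯 x₁ x₂ y₁ y₂ r₁ r₂ = f-poly t∈𝒯 ⟨ x₁ , x₂ ⟩ ⟨ y₁ , y₂ ⟩ λ { zero → r₁ ; (suc _) → r₂ }

    g-cons : IsBinConservative g
    g-cons x y with f-cons ⟨ x , y ⟩
    ... | zero , eq = inj₁ eq
    ... | suc _ , eq = inj₂ eq

    g-comm : IsCommutative g
    g-comm x y = f-tsym ⟨ x , y ⟩ ⟨ y , x ⟩
      (λ { zero → suc zero , refl ; (suc _) → zero , refl })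
      (λ { zero → suc zero , refl ; (suc _) → zero , refl })

  cond2⇒choice : All Distinct 𝒯 → Cond2 𝒯 → PropagatingChoice 𝒯
  cond2⇒choice distinct (g , g-poly , g-cons , g-comm) = record
    { choose = g
    ; conservative = g-cons
    ; commutative = g-comm
    ; propagates = λ {a} {b} {d} t∈𝒯 a-wins → Rel₃-from-first (proj₁ (lookup distinct t∈𝒯))
        (subst (λ x → Rel₃ (a , b , d) x (g b d)) a-wins
          (g-poly t∈𝒯 a b b d (inj₁ (refl , refl)) (inj₂ (inj₂ (refl , refl)))))
    }

invariant-under-surjection : ∀ {f : Op n k} → IsTotallySymmetric f →
  (σ : Fin k → Fin k) → (∀ i → ∃[ j ] σ j ≡ i) → ∀ xs → f xs ≡ f (xs ∘ σ)
invariant-under-surjection f-tsym σ σ-surjective xs = f-tsym xs (xs ∘ σ)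
  (λ i → proj₁ (σ-surjective i) , cong xs (sym (proj₂ (σ-surjective i))))
  (λ j → σ j , refl)

rot-surjective : ∀ (i : Fin k) → ∃[ j ] rot j ≡ i
rot-surjective {suc m} i with m ℕ.≟ toℕ i
... | yes m≡i = zero , toℕ-injective (trans (toℕ-fromℕ m) m≡i)
... | no m≢i = suc (lower₁ i m≢i) , inject₁-lower₁ i m≢i

module _ {𝒯 : Triples n} where

  cond3⇒cond5 : Cond3 𝒯 k → Cond5 𝒯 k
  cond3⇒cond5 (f , f-poly , f-cons , f-tsym) = f , f-poly , f-cons ,
    λ xs π → invariant-under-surjection f-tsym (π ⟨$⟩ʳ_) (λ i → π ⟨$⟩ˡ i , inverseʳ π) xs

  cond3⇒cond6 : Cond3 𝒯 k → Cond6 𝒯 k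
  cond3⇒cond6 (f , f-poly , f-cons , f-tsym) = f , f-poly , f-cons ,
    invariant-under-surjection f-tsym rot rot-surjective

byParity : ∀ {A : Set} → A → A → Parity → A
byParity x y 0ℙ = x
byParity x y 1ℙ = y

byParity-⁻¹ : ∀ {A : Set} (x y : A) p → byParity x y (p ⁻¹) ≡ byParity y x p
byParity-⁻¹ x y 0ℙ = refl
byParity-⁻¹ x y 1ℙ = refl

alternate : ∀ {A : Set} → A → A → Fin k → A
alternate x y i = byParity x y (parity (toℕ i))

ReversesParity : (Fin k → Fin k) → Set
ReversesParity σ = ∀ i → parity (toℕ (σ i)) ≡ parity (toℕ i) ⁻¹

alternate-∘-reversal : ∀ {A : Set} {σ : Fin k → Fin k} → ReversesParity σ →
  (x y : A) → ∀ i → alternate x y (σ i) ≡ alternate y x i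
alternate-∘-reversal σ-rev x y i = trans (cong (byParity x y) (σ-rev i)) (byParity-⁻¹ x y _)

even-parity : 2 ∣ k → parity k ≡ 0ℙ
even-parity (divides q refl) = trans (*-homo-* q 2) (*-zeroʳ (parity q))

rot-reversesParity : parity k ≡ 0ℙ → ReversesParity (rot {k})
rot-reversesParity {suc m} even zero = begin
  parity (toℕ (fromℕ m)) ≡⟨ cong parity (toℕ-fromℕ m) ⟩
  parity m              ≡⟨ sym (suc-homo-⁻¹ m) ⟩
  parity (suc m) ⁻¹     ≡⟨ cong _⁻¹ even ⟩
  1ℙ                    ∎
  where open ≡-Reasoning
rot-reversesParity {suc m} _ (suc i) = trans (cong parity (toℕ-inject₁ i)) (sym (suc-homo-⁻¹ (toℕ i)))

-- opposite i = k - 1 - i, and k - 1 is odd.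
opposite-reversesParity : parity k ≡ 0ℙ → ReversesParity (opposite {k})
opposite-reversesParity {suc m} even i = +-cancelʳ-≡ (parity (toℕ i)) _ _ (begin
  parity (toℕ (opposite i)) + parity (toℕ i) ≡⟨ sym (+-homo-+ (toℕ (opposite i)) (toℕ i)) ⟩
  parity (toℕ (opposite i) ℕ.+ toℕ i)        ≡⟨ cong (λ j → parity (j ℕ.+ toℕ i)) (opposite-prop i) ⟩
  parity (m ℕ.∸ toℕ i ℕ.+ toℕ i)             ≡⟨ cong parity (m∸n+n≡m (toℕ≤pred[n] i)) ⟩
  parity m                                   ≡⟨ sym (suc-homo-⁻¹ m) ⟩
  parity (suc m) ⁻¹                          ≡⟨ cong _⁻¹ even ⟩
  1ℙ                                         ≡⟨ sym (p⁻¹+p≡1ℙ (parity (toℕ i))) ⟩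
  parity (toℕ i) ⁻¹ + parity (toℕ i)         ∎)
  where open ≡-Reasoning

ordered : Fin n → Fin n → Fin n × Fin n
ordered x y with x ≤? y
... | yes _ = x , y
... | no _ = y , x

ordered-cases : ∀ (x y : Fin n) → ordered x y ≡ (x , y) ⊎ ordered x y ≡ (y , x)
ordered-cases x y with x ≤? y
... | yes _ = inj₁ refl
... | no _ = inj₂ refl

ordered-comm : ∀ (x y : Fin n) → ordered x y ≡ ordered y x
ordered-comm x y with x ≤? y | y ≤? x
... | yes x≤y | yes y≤x = cong₂ _,_ (≤-antisym x≤y y≤x) (≤-antisym y≤x x≤y)
... | yes _ | no _ = refl
... | no _ | yes _ = refl
... | no x≰y | no y≰x with ≤-total x y
...   | inj₁ x≤y = contradiction x≤y x≰y
...   | inj₂ y≤x = contradiction y≤x y≰x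

-- Without function extensionality f need not identify pointwise equal tuples, so commutativity is obtained
-- by sorting the two arguments, and the reversal σ only shows that an unsorted pair yields a pointwise equal tuple.
module _ {𝒯 : Triples n} (f : Op n k) (f-poly : IsPolymorphism 𝒯 f) (f-cons : IsConservative f)
  {σ : Fin k → Fin k} (σ-rev : ReversesParity σ) (f-inv : ∀ xs → f xs ≡ f (xs ∘ σ)) where

  private
    g : Fin n → Fin n → Fin n
    g x y = f (alternate (proj₁ (ordered x y)) (proj₂ (ordered x y)))

    g-as-f : ∀ x y → ∃[ xs ] (g x y ≡ f xs × ∀ (i : Fin k) → xs i ≡ alternate x y i)
    g-as-f x y with ordered x y | ordered-cases x y
    ... | _ | inj₁ refl = alternate x y , refl , λ _ → refl
    ... | _ | inj₂ refl = alternate y x ∘ σ , f-inv (alternate y x) , alternate-∘-reversal {σ = σ} σ-rev y x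

    alternate-∈ : ∀ (x y : Fin n) (i : Fin k) → alternate x y i ≡ x ⊎ alternate x y i ≡ y
    alternate-∈ x y i with parity (toℕ i)
    ... | 0ℙ = inj₁ refl
    ... | 1ℙ = inj₂ refl

    alternate-Rel : ∀ {θ : Fin n → Fin n → Set} {x₁ x₂ y₁ y₂} → θ x₁ y₁ → θ x₂ y₂ →
                    ∀ (i : Fin k) → θ (alternate x₁ x₂ i) (alternate y₁ y₂ i)
    alternate-Rel r₁ r₂ i with parity (toℕ i)
    ... | 0ℙ = r₁
    ... | 1ℙ = r₂

  parityReversal⇒cond2 : Cond2 𝒯
  parityReversal⇒cond2 = g , g-poly , g-cons , g-comm
    where
    g-poly : IsBinPolymorphism 𝒯 g
    g-poly {t} t∈𝒯 x₁ x₂ y₁ y₂ r₁ r₂ with g-as-f x₁ x₂ | g-as-f y₁ y₂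
    ... | xs , gx≡fxs , xs≗ | ys , gy≡fys , ys≗ = subst₂ (Rel₃ t) (sym gx≡fxs) (sym gy≡fys)
      (f-poly t∈𝒯 xs ys λ i → subst₂ (Rel₃ t) (sym (xs≗ i)) (sym (ys≗ i)) (alternate-Rel {θ = Rel₃ t} r₁ r₂ i))

    g-cons : IsBinConservative g
    g-cons x y with g-as-f x y
    ... | xs , gxy≡fxs , xs≗ with f-cons xs
    ...   | i , fxs≡xsi = subst (λ z → z ≡ x ⊎ z ≡ y) (sym (trans gxy≡fxs (trans fxs≡xsi (xs≗ i)))) (alternate-∈ x y i)

    g-comm : IsCommutative g
    g-comm x y = cong (λ p → f (alternate (proj₁ p) (proj₂ p))) (ordered-comm x y)

module _ {𝒯 : Triples n} (k-even : 2 ∣ k) where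

  cond5⇒cond2 : Cond5 𝒯 k → Cond2 𝒯
  cond5⇒cond2 (f , f-poly , f-cons , f-sym) =
    parityReversal⇒cond2 f f-poly f-cons (opposite-reversesParity (even-parity k-even)) (λ xs → f-sym xs reverse)

  cond6⇒cond2 : Cond6 𝒯 k → Cond2 𝒯
  cond6⇒cond2 (f , f-poly , f-cons , f-cyc) =
    parityReversal⇒cond2 f f-poly f-cons (rot-reversesParity (even-parity k-even)) f-cyc

lemma6p13 : (n : ℕ) (𝒯 : Triples n) → All Distinct 𝒯 → (k : ℕ) → 2 ≤ k →
    (Cond1 𝒯 ⇔ Cond2 𝒯) × (Cond1 𝒯 ⇔ Cond3 𝒯 k) × (Cond1 𝒯 ⇔ Cond4 𝒯) ×
    (2 ∣ k → (Cond1 𝒯 ⇔ Cond5 𝒯 k) × (Cond1 𝒯 ⇔ Cond6 𝒯 k))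
lemma6p13 n 𝒯 distinct (suc (suc m)) (s≤s (s≤s _)) =
  mk⇔ (cond3⇒cond2 0 ∘ cond4⇒cond3 1 ∘ cond1⇒cond4) cond2⇒cond1 ,
  mk⇔ cond1⇒cond3 (cond2⇒cond1 ∘ cond3⇒cond2 m) ,
  mk⇔ cond1⇒cond4 (cond2⇒cond1 ∘ cond3⇒cond2 0 ∘ cond4⇒cond3 1) ,
  λ k-even → mk⇔ (cond3⇒cond5 ∘ cond1⇒cond3) (cond2⇒cond1 ∘ cond5⇒cond2 k-even) ,
             mk⇔ (cond3⇒cond6 ∘ cond1⇒cond3) (cond2⇒cond1 ∘ cond6⇒cond2 k-even)
  where
  cond1⇒cond4 : Cond1 𝒯 → Cond4 𝒯
  cond1⇒cond4 = choice⇒cond4 distinct ∘ consistent⇒choice 𝒯 distinct ∘ cond1⇒consistent 𝒯 distinct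
  cond1⇒cond3 : Cond1 𝒯 → Cond3 𝒯 (suc (suc m))
  cond1⇒cond3 = cond4⇒cond3 (suc m) ∘ cond1⇒cond4
  cond2⇒cond1 : Cond2 𝒯 → Cond1 𝒯
  cond2⇒cond1 = choice⇒cond1 𝒯 distinct ∘ cond2⇒choice distinct
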